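{- For every $n\ge 2$, exactly half of the full permutations of $[n]$ are indecomposable and half are decomposable.
   Context: $[n]=\{1,\dots,n\}$; a permutation $\pi=a_1\cdots a_n$ (one-line notation) has permutation matrix with a $1$ in row $n+1-a_j$, column $j$. Bootstrap percolation: a cell is mutable if it contains $0$ and at least two of its orthogonal neighbours contain $1$; mutable cells are changed to $1$ one at a time until none remain (final configuration independent of the order). $\pi$ is full if the final configuration is the all-ones $n\times n$ matrix. $\pi$ is indecomposable if there is no $1\le k<n$ with $\pi(\{1,\dots,k\})=\{1,\dots,k\}$, and decomposable otherwise. -}

module Defs where

open import Data.Nat using (ℕ; zero; suc; _+_; _<_; _≤_; ∣_-_∣)
open import Data.Fin using (Fin; toℕ; opposite)
open import Data.Vec using (Vec; []; _∷_; lookup)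
open import Data.List using (List; []; _∷_; map; concatMap; allFin; length; filter)
open import Data.Product using (_×_; _,_; Σ; ∃)
open import Relation.Nullary using (¬_)
open import Relation.Unary using (Pred; Decidable)
open import Level using (0ℓ)
open import Relation.Binary.PropositionalEquality using (_≡_; _≢_)

-- A candidate permutation of [n] in one-line notation a₁ ⋯ aₙ,
-- with values and positions 0-indexed (value i : Fin n stands for i+1).
Word : ℕ → Set
Word n = Vec (Fin n) n

allWords : (n k : ℕ) → List (Vec (Fin n) k)
allWords n zero    = [] ∷ []
allWords n (suc k) = concatMap (λ i → map (i ∷_) (allWords n k)) (allFin n)

-- The word is a permutation (injective, hence bijective on Fin n).
IsPerm : {n : ℕ} → Word n → Set
IsPerm {n} π = (i j : Fin n) → lookup π i ≡ lookup π j → i ≡ j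

-- Cells of the n×n grid: (row , column), 0-indexed.
Cell : ℕ → Set
Cell n = Fin n × Fin n

Adjacent : {n : ℕ} → Cell n → Cell n → Set
Adjacent (r , c) (r' , c') = ∣ toℕ r - toℕ r' ∣ + ∣ toℕ c - toℕ c' ∣ ≡ 1

-- Permutation matrix: a 1 in row n+1-a_j, column j (1-indexed), i.e.
-- 0-indexed row (n-1) - a_j = opposite a_j, column j.
data Infected {n : ℕ} (π : Word n) : Cell n → Set where
  initial : (j : Fin n) → Infected π (opposite (lookup π j) , j)
  spread  : {x a b : Cell n} → a ≢ b → Adjacent a x → Adjacent b x →
            Infected π a → Infected π b → Infected π x

-- Full: the final configuration of bootstrap percolation is all ones.
Full : {n : ℕ} → Word n → Set
Full {n} π = (x : Cell n) → Infected π x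

Decomposable : {n : ℕ} → Word n → Set
Decomposable {n} π =
  Σ ℕ λ k → 1 ≤ k × k < n ×
    ((i : Fin n) → toℕ i < k → toℕ (lookup π i) < k) ×
    ((j : Fin n) → toℕ j < k → Σ (Fin n) λ i → toℕ i < k × lookup π i ≡ j)

Indecomposable : {n : ℕ} → Word n → Set
Indecomposable π = ¬ Decomposable π

count : {A : Set} {P : Pred A 0ℓ} → Decidable P → List A → ℕ
count P? xs = length (filter P? xs)

fullPerms : (n : ℕ) → Decidable (IsPerm {n}) → Decidable (Full {n}) → List (Word n)
fullPerms n perm? full? = filter full? (filter perm? (allWords n n))

{-# OPTIONS --safe #-}
-- Complementation x ↦ n+1-x turns the permutation matrix upside down, so it maps full
-- permutations to full permutations; for n ≥ 2 it exchanges the decomposable and the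
-- indecomposable ones.
--
-- At most one of x and its complement x̄ is decomposable: if x fixes {1..k} and x̄ fixes
-- {1..k′} with k ≤ k′, the position where x takes the value 1 lies in {1..k′}, but there x̄
-- takes the value n > k′.
--
-- At least one is, if x is full. Call a block of a permutation a run of consecutive positions
-- whose values are consecutive, and call it proper if it misses some position. Every infected
-- cell lies in the rectangle (positions × values) of a proper block of x̄, whose values are the
-- rows of the 1s: the 1s themselves are singleton blocks, and a cell with two infected
-- neighbours lies in the hull of two such rectangles, which touch and hence merge into one
-- block. If the merged block covers all positions, the block containing position 1 is a proper
-- initial segment whose values form an initial or a final segment, i.e. a decomposition of x̄
-- or of x. Otherwise the invariant persists; but a block whose rectangle contains the cell in
-- column 1 and in the row of the last column's 1 covers all positions, so that cell is never
-- infected.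
module Submission where

open import Defs
open import Data.Bool using (true; false)
open import Data.Empty using (⊥; ⊥-elim)
open import Data.Fin using (Fin; zero; suc; toℕ; opposite; inject₁; inject≤; fromℕ; fromℕ<; punchOut)
open import Data.Fin.Properties
  using (opposite-prop; opposite-involutive; toℕ-injective; toℕ<n; toℕ≤pred[n]; ≤fromℕ; toℕ-fromℕ;
         toℕ-inject≤; inject≤-injective; fromℕ<-injective; injective⇒≤; punchOut-injective; any?; all?; _≟_)
open import Data.List using (List; []; _∷_; map; concatMap; allFin; length; filter; reverse; tabulate; _++_; _∷ʳ_)
open import Data.List.Properties
  using (map-tabulate; reverse-++; unfold-reverse; concatMap-++; ++-identityʳ; map-concatMap;
         concatMap-cong; concatMap-map; reverse-map; filter-≐)
import Data.List.Properties as List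
open import Data.List.Relation.Unary.All using (All; []; _∷_)
import Data.List.Relation.Unary.All as All
open import Data.List.Relation.Unary.All.Properties using (all-filter; filter⁺)
open import Data.List.Relation.Binary.Permutation.Propositional using (_↭_; ↭-sym)
open import Data.List.Relation.Binary.Permutation.Propositional.Properties using (↭-length; filter-↭; ↭-reverse)
open import Data.Nat using (ℕ; zero; suc; _+_; _*_; _∸_; _≤_; _<_; _⊓_; _⊔_; ∣_-_∣; z≤n; s≤s; s≤s⁻¹)
open import Data.Nat.Properties
  using (+-suc; +-identityʳ; +-comm; ≤-refl; ≤-trans; ≤-antisym; ≤-total; <⇒≤; <⇒≱; <-≤-trans;
         ≰⇒>; ≮⇒≥; >⇒≢; <⇒≢; n≤1+n; m≤m+n; m+n≡0⇒n≡0; suc-injective; ∣m-n∣≡0⇒m≡n; ∣n-n∣≡0;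
         m≤n⇒∣n-m∣≡n∸m; m≤n⇒∣m-n∣≡n∸m; m∸n≤m; m∸[m∸n]≡n; ∸-monoʳ-≤; n∸n≡0; 1+n≰n;
         m⊓n≤m; m⊓n≤n; m≤m⊔n; m≤n⊔m; ⊓-sel; ⊔-sel; _≤?_; _<?_)
import Data.Nat.Properties as ℕ
open import Data.Product using (Σ; ∃; _×_; _,_; proj₁; proj₂; swap)
import Data.Product as Product
open import Data.Sum using (_⊎_; inj₁; inj₂)
import Data.Sum as Sum
open import Data.Vec using (Vec; []; _∷_; lookup)
import Data.Vec as Vec
import Data.Vec.Properties as Vec
open import Function using (_∘_; id; _⇔_; mk⇔; Equivalence)
open import Function.Definitions using (Injective)
open import Level using (0ℓ)
open import Relation.Nullary using (¬_; ¬?; Dec; yes; no; does; contradiction)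
open import Relation.Nullary.Decidable using (_×-dec_)
open import Relation.Unary using (Pred; Decidable; _≐_)
open import Relation.Binary.PropositionalEquality hiding ([_])
open ≡-Reasoning

-- Counting over lists

module _ {A : Set} where

  count-↭ : {P : Pred A 0ℓ} (P? : Decidable P) {xs ys : List A} → xs ↭ ys → count P? xs ≡ count P? ys
  count-↭ P? = ↭-length ∘ filter-↭ P?

  count-map : {B : Set} {P : Pred A 0ℓ} (P? : Decidable P) (f : B → A) (xs : List B) →
              count P? (map f xs) ≡ count (P? ∘ f) xs
  count-map P? f []       = refl
  count-map P? f (x ∷ xs) with does (P? (f x))
  ... | true  = cong suc (count-map P? f xs)
  ... | false = count-map P? f xs

  count+count-∁ : {P : Pred A 0ℓ} (P? : Decidable P) (xs : List A) →
                  count P? xs + count (¬? ∘ P?) xs ≡ length xs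
  count+count-∁ P? []       = refl
  count+count-∁ P? (x ∷ xs) with P? x
  ... | yes _ = cong suc (count+count-∁ P? xs)
  ... | no  _ = trans (+-suc _ _) (cong suc (count+count-∁ P? xs))

  count-cong : {P Q : Pred A 0ℓ} (P? : Decidable P) (Q? : Decidable Q) {xs : List A} →
               All (λ x → P x ⇔ Q x) xs → count P? xs ≡ count Q? xs
  count-cong P? Q? []                  = refl
  count-cong P? Q? {x ∷ _} (P⇔Q ∷ eqs) with P? x | Q? x
  ... | yes _  | yes _  = cong suc (count-cong P? Q? eqs)
  ... | no  _  | no  _  = count-cong P? Q? eqs
  ... | yes Px | no ¬Qx = contradiction (Equivalence.to P⇔Q Px) ¬Qx
  ... | no ¬Px | yes Qx = contradiction (Equivalence.from P⇔Q Qx) ¬Px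

  exactly-half : {P : Pred A 0ℓ} (P? : Decidable P) (σ : A → A) {xs : List A} →
                 map σ xs ↭ xs → All (λ x → P (σ x) ⇔ (¬ P x)) xs →
                 2 * count (¬? ∘ P?) xs ≡ length xs × 2 * count P? xs ≡ length xs
  exactly-half P? σ {xs} σxs↭xs swaps = halves P≡∁P (count+count-∁ P? xs)
    where
    P≡∁P : count P? xs ≡ count (¬? ∘ P?) xs
    P≡∁P = begin
      count P? xs           ≡⟨ count-↭ P? (↭-sym σxs↭xs) ⟩
      count P? (map σ xs)   ≡⟨ count-map P? σ xs ⟩
      count (P? ∘ σ) xs     ≡⟨ count-cong (P? ∘ σ) (¬? ∘ P?) swaps ⟩
      count (¬? ∘ P?) xs    ∎
    halves : {a b l : ℕ} → a ≡ b → a + b ≡ l → 2 * b ≡ l × 2 * a ≡ l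
    halves {a} {l = l} refl a+a≡l = twice , twice
      where
      twice : 2 * a ≡ l
      twice = trans (cong (a +_) (+-identityʳ a)) a+a≡l

  map-filter : {B : Set} {P : Pred B 0ℓ} (f : A → B) (P? : Decidable P) (xs : List A) →
               map f (filter (P? ∘ f) xs) ≡ filter P? (map f xs)
  map-filter f P? []       = refl
  map-filter f P? (x ∷ xs) with does (P? (f x))
  ... | true  = cong (f x ∷_) (map-filter f P? xs)
  ... | false = map-filter f P? xs

  map-filter-↭ : {P : Pred A 0ℓ} (P? : Decidable P) (σ : A → A) → P ≐ (P ∘ σ) →
                 {xs : List A} → map σ xs ↭ xs → map σ (filter P? xs) ↭ filter P? xs
  map-filter-↭ P? σ P≐Pσ {xs} σxs↭xs = subst (_↭ filter P? xs) (sym σ-filter) (filter-↭ P? σxs↭xs)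
    where
    σ-filter : map σ (filter P? xs) ≡ filter P? (map σ xs)
    σ-filter = trans (cong (map σ) (filter-≐ P? (P? ∘ σ) P≐Pσ xs)) (map-filter σ P? xs)

  preserved-by-involution : {P : Pred A 0ℓ} (σ : A → A) → (∀ x → σ (σ x) ≡ x) →
                            (∀ {x} → P x → P (σ x)) → P ≐ (P ∘ σ)
  preserved-by-involution {P} σ σσ≡id preserve = preserve , λ {x} Pσx → subst P (σσ≡id x) (preserve Pσx)

-- Complementation

tabulate-∷ʳ : {A : Set} {n : ℕ} (f : Fin (suc n) → A) → tabulate f ≡ tabulate (f ∘ inject₁) ∷ʳ f (fromℕ n)
tabulate-∷ʳ {n = zero}  f = refl
tabulate-∷ʳ {n = suc n} f = cong (f zero ∷_) (tabulate-∷ʳ (f ∘ suc))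

reverse-tabulate : {A : Set} {n : ℕ} (f : Fin n → A) → reverse (tabulate f) ≡ tabulate (f ∘ opposite)
reverse-tabulate {n = zero}  f = refl
reverse-tabulate {n = suc n} f = begin
  reverse (tabulate f)
    ≡⟨ cong reverse (tabulate-∷ʳ f) ⟩
  reverse (tabulate (f ∘ inject₁) ∷ʳ f (fromℕ n))
    ≡⟨ reverse-++ (tabulate (f ∘ inject₁)) (f (fromℕ n) ∷ []) ⟩
  f (fromℕ n) ∷ reverse (tabulate (f ∘ inject₁))
    ≡⟨ cong (f (fromℕ n) ∷_) (reverse-tabulate (f ∘ inject₁)) ⟩
  tabulate (f ∘ opposite)
    ∎

map-opposite-allFin : (n : ℕ) → map opposite (allFin n) ≡ reverse (allFin n)
map-opposite-allFin n = trans (map-tabulate id opposite) (sym (reverse-tabulate id))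

concatMap-reverse : {A B : Set} (f : A → List B) (xs : List A) →
                    concatMap (reverse ∘ f) (reverse xs) ≡ reverse (concatMap f xs)
concatMap-reverse f []       = refl
concatMap-reverse f (x ∷ xs) = begin
  concatMap (reverse ∘ f) (reverse (x ∷ xs))
    ≡⟨ cong (concatMap (reverse ∘ f)) (unfold-reverse x xs) ⟩
  concatMap (reverse ∘ f) (reverse xs ++ x ∷ [])
    ≡⟨ concatMap-++ (reverse ∘ f) (reverse xs) (x ∷ []) ⟩
  concatMap (reverse ∘ f) (reverse xs) ++ (reverse (f x) ++ [])
    ≡⟨ cong₂ _++_ (concatMap-reverse f xs) (++-identityʳ (reverse (f x))) ⟩
  reverse (concatMap f xs) ++ reverse (f x)
    ≡⟨ reverse-++ (f x) (concatMap f xs) ⟨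
  reverse (f x ++ concatMap f xs)
    ∎

complement : {n k : ℕ} → Vec (Fin n) k → Vec (Fin n) k
complement = Vec.map opposite

map-complement-allWords : (n k : ℕ) → map complement (allWords n k) ≡ reverse (allWords n k)
map-complement-allWords n zero    = refl
map-complement-allWords n (suc k) = begin
  map complement (concatMap extend (allFin n))
    ≡⟨ map-concatMap complement extend (allFin n) ⟩
  concatMap (map complement ∘ extend) (allFin n)
    ≡⟨ concatMap-cong complement-extend (allFin n) ⟩
  concatMap (reverse ∘ extend ∘ opposite) (allFin n)
    ≡⟨ concatMap-map (reverse ∘ extend) opposite (allFin n) ⟨
  concatMap (reverse ∘ extend) (map opposite (allFin n))
    ≡⟨ cong (concatMap (reverse ∘ extend)) (map-opposite-allFin n) ⟩
  concatMap (reverse ∘ extend) (reverse (allFin n))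
    ≡⟨ concatMap-reverse extend (allFin n) ⟩
  reverse (concatMap extend (allFin n))
    ∎
  where
  words : List (Vec (Fin n) k)
  words = allWords n k
  extend : Fin n → List (Vec (Fin n) (suc k))
  extend i = map (i ∷_) words
  complement-extend : (i : Fin n) → map complement (extend i) ≡ reverse (extend (opposite i))
  complement-extend i = begin
    map complement (map (i ∷_) words)           ≡⟨ List.map-∘ words ⟨
    map ((opposite i ∷_) ∘ complement) words    ≡⟨ List.map-∘ words ⟩
    map (opposite i ∷_) (map complement words)  ≡⟨ cong (map (opposite i ∷_)) (map-complement-allWords n k) ⟩
    map (opposite i ∷_) (reverse words)         ≡⟨ reverse-map (opposite i ∷_) words ⟩
    reverse (map (opposite i ∷_) words)         ∎

lookup-complement : {n k : ℕ} (x : Vec (Fin n) k) (i : Fin k) → lookup (complement x) i ≡ opposite (lookup x i)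
lookup-complement x i = Vec.lookup-map i opposite x

complement-involutive : {n k : ℕ} (x : Vec (Fin n) k) → complement (complement x) ≡ x
complement-involutive []      = refl
complement-involutive (a ∷ x) = cong₂ _∷_ (opposite-involutive a) (complement-involutive x)

opposite-injective : {n : ℕ} → Injective {A = Fin n} _≡_ _≡_ opposite
opposite-injective {x = a} {b} e = begin
  a                      ≡⟨ opposite-involutive a ⟨
  opposite (opposite a)  ≡⟨ cong opposite e ⟩
  opposite (opposite b)  ≡⟨ opposite-involutive b ⟩
  b                      ∎

IsPerm-complement : {n : ℕ} {x : Word n} → IsPerm x → IsPerm (complement x)
IsPerm-complement {x = x} perm i j e = perm i j (opposite-injective (begin
  opposite (lookup x i)   ≡⟨ lookup-complement x i ⟨
  lookup (complement x) i ≡⟨ e ⟩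
  lookup (complement x) j ≡⟨ lookup-complement x j ⟩
  opposite (lookup x j)   ∎))

∣o∸m-o∸n∣≡∣m-n∣ : ∀ o m n → m ≤ o → n ≤ o → ∣ o ∸ m - o ∸ n ∣ ≡ ∣ m - n ∣
∣o∸m-o∸n∣≡∣m-n∣ o       zero    zero    _         _         = ∣n-n∣≡0 o
∣o∸m-o∸n∣≡∣m-n∣ o       zero    (suc n) _         1+n≤o     = trans (m≤n⇒∣n-m∣≡n∸m (m∸n≤m o (suc n))) (m∸[m∸n]≡n 1+n≤o)
∣o∸m-o∸n∣≡∣m-n∣ o       (suc m) zero    1+m≤o     _         = trans (m≤n⇒∣m-n∣≡n∸m (m∸n≤m o (suc m))) (m∸[m∸n]≡n 1+m≤o)
∣o∸m-o∸n∣≡∣m-n∣ (suc o) (suc m) (suc n) (s≤s m≤o) (s≤s n≤o) = ∣o∸m-o∸n∣≡∣m-n∣ o m n m≤o n≤o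

opposite-preserves-∣-∣ : {n : ℕ} (a b : Fin n) → ∣ toℕ (opposite a) - toℕ (opposite b) ∣ ≡ ∣ toℕ a - toℕ b ∣
opposite-preserves-∣-∣ {suc n} a b rewrite opposite-prop a | opposite-prop b =
  ∣o∸m-o∸n∣≡∣m-n∣ n (toℕ a) (toℕ b) (toℕ≤pred[n] a) (toℕ≤pred[n] b)

flipRow : {n : ℕ} → Cell n → Cell n
flipRow (r , c) = opposite r , c

flipRow-involutive : {n : ℕ} (X : Cell n) → flipRow (flipRow X) ≡ X
flipRow-involutive (r , c) = cong (_, c) (opposite-involutive r)

flipRow-injective : {n : ℕ} → Injective {A = Cell n} _≡_ _≡_ flipRow
flipRow-injective {x = X} {Y} e = begin
  X                    ≡⟨ flipRow-involutive X ⟨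
  flipRow (flipRow X)  ≡⟨ cong flipRow e ⟩
  flipRow (flipRow Y)  ≡⟨ flipRow-involutive Y ⟩
  Y                    ∎

Adjacent-flipRow : {n : ℕ} {X Y : Cell n} → Adjacent X Y → Adjacent (flipRow X) (flipRow Y)
Adjacent-flipRow {X = r , c} {r′ , c′} adj = trans (cong (_+ ∣ toℕ c - toℕ c′ ∣) (opposite-preserves-∣-∣ r r′)) adj

Infected-complement : {n : ℕ} {x : Word n} {X : Cell n} → Infected x X → Infected (complement x) (flipRow X)
Infected-complement {x = x} (initial j) =
  subst (λ v → Infected (complement x) (opposite v , j)) (lookup-complement x j) (initial j)
Infected-complement (spread {X} {A} {B} A≢B adjA adjB infA infB) =
  spread (A≢B ∘ flipRow-injective) (Adjacent-flipRow {X = A} {X} adjA) (Adjacent-flipRow {X = B} {X} adjB)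
         (Infected-complement infA) (Infected-complement infB)

Full-complement : {n : ℕ} {x : Word n} → Full x → Full (complement x)
Full-complement {x = x} full X =
  subst (Infected (complement x)) (flipRow-involutive X) (Infected-complement (full (flipRow X)))

fullPerms-complement-↭ : (n : ℕ) (perm? : Decidable (IsPerm {n})) (full? : Decidable (Full {n})) →
                         map complement (fullPerms n perm? full?) ↭ fullPerms n perm? full?
fullPerms-complement-↭ n perm? full? =
  map-filter-↭ full? complement (complement-invariant (λ {x} → Full-complement {x = x}))
    (map-filter-↭ perm? complement (complement-invariant (λ {x} → IsPerm-complement {x = x}))
      (subst (_↭ allWords n n) (sym (map-complement-allWords n n)) (↭-reverse (allWords n n))))
  where
  complement-invariant : {P : Pred (Word n) 0ℓ} → (∀ {x} → P x → P (complement x)) → P ≐ (P ∘ complement)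
  complement-invariant = preserved-by-involution complement complement-involutive

fullPerms-sound : (n : ℕ) (perm? : Decidable (IsPerm {n})) (full? : Decidable (Full {n})) →
                  All (λ x → IsPerm x × Full x) (fullPerms n perm? full?)
fullPerms-sound n perm? full? =
  All.zip (filter⁺ full? (all-filter perm? (allWords n n)) , all-filter full? (filter perm? (allWords n n)))

Complementary : {M : ℕ} → Word (suc M) → Word (suc M) → Set
Complementary {M} w w′ = (p : Fin (suc M)) → toℕ (lookup w′ p) ≡ M ∸ toℕ (lookup w p)

complement-complementary : {M : ℕ} (w : Word (suc M)) → Complementary w (complement w)
complement-complementary w p = trans (cong toℕ (lookup-complement w p)) (opposite-prop (lookup w p))

Complementary-sym : {M : ℕ} {w w′ : Word (suc M)} → Complementary w w′ → Complementary w′ w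
Complementary-sym {M} {w} {w′} comp p = begin
  toℕ (lookup w p)            ≡⟨ m∸[m∸n]≡n (toℕ≤pred[n] (lookup w p)) ⟨
  M ∸ (M ∸ toℕ (lookup w p))  ≡⟨ cong (M ∸_) (comp p) ⟨
  M ∸ toℕ (lookup w′ p)       ∎

no-nested-complementary-decompositions : {M : ℕ} {w w′ : Word (suc M)} → Complementary w w′ →
  (d : Decomposable w) (d′ : Decomposable w′) → proj₁ d ≤ proj₁ d′ → ⊥
no-nested-complementary-decompositions {M} {w} {w′} comp
  (k , 1≤k , _ , _ , onto) (k′ , _ , k′<n , into′ , _) k≤k′ with onto zero 1≤k
... | i , i<k , wi≡0 = <⇒≱ k′<n (subst (_< k′) w′i≡M (into′ i (<-≤-trans i<k k≤k′)))
  where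
  w′i≡M : toℕ (lookup w′ i) ≡ M
  w′i≡M = trans (comp i) (cong (λ v → M ∸ toℕ v) wi≡0)

not-both-decomposable : {M : ℕ} {w w′ : Word (suc M)} → Complementary w w′ →
                        Decomposable w → ¬ Decomposable w′
not-both-decomposable {w = w} {w′} comp d d′ with ≤-total (proj₁ d) (proj₁ d′)
... | inj₁ k≤k′ = no-nested-complementary-decompositions {w = w} {w′} comp d d′ k≤k′
... | inj₂ k′≤k =
  no-nested-complementary-decompositions {w = w′} {w} (Complementary-sym {w = w} {w′} comp) d′ d k′≤k

-- Intervals and unit steps

record Interval : Set where
  constructor [_,_]
  field
    lo hi : ℕ
open Interval

infix 4 _∈ᵢ_ _∈ᵢ?_
_∈ᵢ_ : ℕ → Interval → Set
t ∈ᵢ I = lo I ≤ t × t ≤ hi I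

_∈ᵢ?_ : (t : ℕ) (I : Interval) → Dec (t ∈ᵢ I)
t ∈ᵢ? I = (lo I ≤? t) ×-dec (t ≤? hi I)

infixl 6 _∪ᵢ_
_∪ᵢ_ : Interval → Interval → Interval
I ∪ᵢ J = [ lo I ⊓ lo J , hi I ⊔ hi J ]

Touching : Interval → Interval → Set
Touching I J = lo I ≤ suc (hi J) × lo J ≤ suc (hi I)

mirror : ℕ → Interval → Interval
mirror M I = [ M ∸ hi I , M ∸ lo I ]

Between : ℕ → ℕ → ℕ → Set
Between s t u = (s ≤ u ⊎ t ≤ u) × (u ≤ s ⊎ u ≤ t)

∈-point⁺ : {s : ℕ} → s ∈ᵢ [ s , s ]
∈-point⁺ = ≤-refl , ≤-refl

∈-point⁻ : {s t : ℕ} → t ∈ᵢ [ s , s ] → t ≡ s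
∈-point⁻ (s≤t , t≤s) = ≤-antisym t≤s s≤t

∈-convex : {I : Interval} {s t u : ℕ} → s ∈ᵢ I → u ∈ᵢ I → s ≤ t → t ≤ u → t ∈ᵢ I
∈-convex (lo≤s , _) (_ , u≤hi) s≤t t≤u = ≤-trans lo≤s s≤t , ≤-trans t≤u u≤hi

∈-∪ˡ : {I J : Interval} {t : ℕ} → t ∈ᵢ I → t ∈ᵢ I ∪ᵢ J
∈-∪ˡ {I} {J} (lo≤t , t≤hi) = ≤-trans (m⊓n≤m (lo I) (lo J)) lo≤t , ≤-trans t≤hi (m≤m⊔n (hi I) (hi J))

∈-∪ʳ : {I J : Interval} {t : ℕ} → t ∈ᵢ J → t ∈ᵢ I ∪ᵢ J
∈-∪ʳ {I} {J} (lo≤t , t≤hi) = ≤-trans (m⊓n≤n (lo I) (lo J)) lo≤t , ≤-trans t≤hi (m≤n⊔m (hi I) (hi J))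

m⊓n≤o⇒n≤o : {m n o : ℕ} → o < m → m ⊓ n ≤ o → n ≤ o
m⊓n≤o⇒n≤o {m} {n} o<m m⊓n≤o with ⊓-sel m n
... | inj₁ m⊓n≡m = contradiction (subst (_≤ _) m⊓n≡m m⊓n≤o) (<⇒≱ o<m)
... | inj₂ m⊓n≡n = subst (_≤ _) m⊓n≡n m⊓n≤o

o≤m⊔n⇒o≤n : {m n o : ℕ} → m < o → o ≤ m ⊔ n → o ≤ n
o≤m⊔n⇒o≤n {m} {n} m<o o≤m⊔n with ⊔-sel m n
... | inj₁ m⊔n≡m = contradiction (subst (_ ≤_) m⊔n≡m o≤m⊔n) (<⇒≱ m<o)
... | inj₂ m⊔n≡n = subst (_ ≤_) m⊔n≡n o≤m⊔n

∈-∪⁻ : {I J : Interval} {t : ℕ} → Touching I J → t ∈ᵢ I ∪ᵢ J → t ∈ᵢ I ⊎ t ∈ᵢ J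
∈-∪⁻ {I} {J} {t} (loI≤ , loJ≤) (lo≤t , t≤hi) with lo I ≤? t | t ≤? hi I
... | yes loI≤t | yes t≤hiI = inj₁ (loI≤t , t≤hiI)
... | yes _     | no  t≰hiI = inj₂ (≤-trans loJ≤ (≰⇒> t≰hiI) , o≤m⊔n⇒o≤n (≰⇒> t≰hiI) t≤hi)
... | no  loI≰t | _         = inj₂ (m⊓n≤o⇒n≤o (≰⇒> loI≰t) lo≤t , s≤s⁻¹ (≤-trans (≰⇒> loI≰t) loI≤))

∈-∪-between : {I J : Interval} {s t u : ℕ} → s ∈ᵢ I → t ∈ᵢ J → Between s t u → u ∈ᵢ I ∪ᵢ J
∈-∪-between {I} {J} {s} {t} s∈I t∈J (below , above) =
  Sum.[ ≤-trans (proj₁ s∈I∪J) , ≤-trans (proj₁ t∈I∪J) ] below ,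
  Sum.[ (λ u≤s → ≤-trans u≤s (proj₂ s∈I∪J)) , (λ u≤t → ≤-trans u≤t (proj₂ t∈I∪J)) ] above
  where
  s∈I∪J : s ∈ᵢ I ∪ᵢ J
  s∈I∪J = ∈-∪ˡ s∈I
  t∈I∪J : t ∈ᵢ I ∪ᵢ J
  t∈I∪J = ∈-∪ʳ t∈J

touching-near : {I J : Interval} {s t : ℕ} → s ∈ᵢ I → t ∈ᵢ J → s ≤ suc t → t ≤ suc s → Touching I J
touching-near (lo≤s , s≤hi) (lo≤t , t≤hi) s≤1+t t≤1+s =
  ≤-trans lo≤s (≤-trans s≤1+t (s≤s t≤hi)) , ≤-trans lo≤t (≤-trans t≤1+s (s≤s s≤hi))

touching-shared : {I J : Interval} {t : ℕ} → t ∈ᵢ I → t ∈ᵢ J → Touching I J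
touching-shared t∈I t∈J = touching-near t∈I t∈J (n≤1+n _) (n≤1+n _)

∸-cancelˡ-≤ : {M s t : ℕ} → t ≤ M → M ∸ s ≤ M ∸ t → t ≤ s
∸-cancelˡ-≤                 z≤n       _ = z≤n
∸-cancelˡ-≤ {suc M} {zero}  {suc t} (s≤s t≤M) M+1≤M∸t = contradiction (≤-trans M+1≤M∸t (m∸n≤m M t)) 1+n≰n
∸-cancelˡ-≤ {suc M} {suc s} {suc t} (s≤s t≤M) M∸s≤M∸t = s≤s (∸-cancelˡ-≤ {M} {s} t≤M M∸s≤M∸t)

∈-mirror⁺ : {M t : ℕ} {I : Interval} → t ∈ᵢ I → M ∸ t ∈ᵢ mirror M I
∈-mirror⁺ {M} (lo≤t , t≤hi) = ∸-monoʳ-≤ M t≤hi , ∸-monoʳ-≤ M lo≤t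

∈-mirror⁻ : {M t : ℕ} {I : Interval} → lo I ≤ M → t ≤ M → M ∸ t ∈ᵢ mirror M I → t ∈ᵢ I
∈-mirror⁻ {M} {t} {I} lo≤M t≤M (l , u) = ∸-cancelˡ-≤ {M} {t} lo≤M u , ∸-cancelˡ-≤ {M} {hi I} t≤M l

-- A record, so that the coordinates can be inferred from a proof; a proof of Adjacent X Y
-- is a proof of its field at coords X and coords Y.
record UnitStep (A X : ℕ × ℕ) : Set where
  constructor unit-step
  field
    distance≡1 : ∣ proj₁ A - proj₁ X ∣ + ∣ proj₂ A - proj₂ X ∣ ≡ 1

UnitStep-transpose : {A X : ℕ × ℕ} → UnitStep A X → UnitStep (swap A) (swap X)
UnitStep-transpose {a , a′} {x , x′} (unit-step d≡1) = unit-step (trans (+-comm ∣ a′ - x′ ∣ ∣ a - x ∣) d≡1)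

∣-∣≤1⇒near : ∀ a x → ∣ a - x ∣ ≤ 1 → a ≤ suc x × x ≤ suc a
∣-∣≤1⇒near zero    x       x≤1   = z≤n , x≤1
∣-∣≤1⇒near (suc a) zero    1+a≤1 = 1+a≤1 , z≤n
∣-∣≤1⇒near (suc a) (suc x) d≤1   = Product.map s≤s s≤s (∣-∣≤1⇒near a x d≤1)

step-near : {a a′ x x′ : ℕ} → UnitStep (a , a′) (x , x′) → a ≤ suc x × x ≤ suc a
step-near {a} {a′} {x} {x′} (unit-step d≡1) =
  ∣-∣≤1⇒near a x (subst (∣ a - x ∣ ≤_) d≡1 (m≤m+n ∣ a - x ∣ ∣ a′ - x′ ∣))

step-aligned : {a a′ x x′ : ℕ} → UnitStep (a , a′) (x , x′) → a ≢ x → a′ ≡ x′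
step-aligned {a} {a′} {x} {x′} (unit-step d≡1) a≢x with ∣ a - x ∣ in d≡
... | zero  = contradiction (∣m-n∣≡0⇒m≡n d≡) a≢x
... | suc d = ∣m-n∣≡0⇒m≡n (m+n≡0⇒n≡0 d (suc-injective d≡1))

steps-near-or-aligned : {a a′ b b′ x x′ : ℕ} → UnitStep (a , a′) (x , x′) → UnitStep (b , b′) (x , x′) →
                        (a ≤ suc b × b ≤ suc a) ⊎ a′ ≡ b′
steps-near-or-aligned {a} {b = b} {x = x} stepA stepB with a ℕ.≟ x | b ℕ.≟ x
... | yes refl | _        = inj₁ (swap (step-near stepB))
... | _        | yes refl = inj₁ (step-near stepA)
... | no a≢x   | no b≢x   = inj₂ (trans (step-aligned stepA a≢x) (sym (step-aligned stepB b≢x)))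

both-above⇒equal : {a a′ b b′ x x′ : ℕ} → UnitStep (a , a′) (x , x′) → UnitStep (b , b′) (x , x′) →
                   x < a → x < b → (a , a′) ≡ (b , b′)
both-above⇒equal stepA stepB x<a x<b = cong₂ _,_
  (trans (≤-antisym (proj₁ (step-near stepA)) x<a) (sym (≤-antisym (proj₁ (step-near stepB)) x<b)))
  (trans (step-aligned stepA (>⇒≢ x<a)) (sym (step-aligned stepB (>⇒≢ x<b))))

both-below⇒equal : {a a′ b b′ x x′ : ℕ} → UnitStep (a , a′) (x , x′) → UnitStep (b , b′) (x , x′) →
                   a < x → b < x → (a , a′) ≡ (b , b′)
both-below⇒equal stepA stepB a<x b<x = cong₂ _,_
  (suc-injective (trans (≤-antisym a<x (proj₂ (step-near stepA))) (sym (≤-antisym b<x (proj₂ (step-near stepB))))))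
  (trans (step-aligned stepA (<⇒≢ a<x)) (sym (step-aligned stepB (<⇒≢ b<x))))

steps-between₁ : {a a′ b b′ x x′ : ℕ} → UnitStep (a , a′) (x , x′) → UnitStep (b , b′) (x , x′) →
                 (a , a′) ≢ (b , b′) → Between a b x
steps-between₁ {a} {a′} {b} {b′} {x} stepA stepB A≢B = below , above
  where
  below : a ≤ x ⊎ b ≤ x
  below with a ≤? x | b ≤? x
  ... | yes a≤x | _       = inj₁ a≤x
  ... | no _    | yes b≤x = inj₂ b≤x
  ... | no a≰x  | no b≰x  = contradiction (both-above⇒equal stepA stepB (≰⇒> a≰x) (≰⇒> b≰x)) A≢B
  above : x ≤ a ⊎ x ≤ b
  above with x ≤? a | x ≤? b
  ... | yes x≤a | _       = inj₁ x≤a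
  ... | no _    | yes x≤b = inj₂ x≤b
  ... | no x≰a  | no x≰b  = contradiction (both-below⇒equal stepA stepB (≰⇒> x≰a) (≰⇒> x≰b)) A≢B

steps-between : {a a′ b b′ x x′ : ℕ} → UnitStep (a , a′) (x , x′) → UnitStep (b , b′) (x , x′) →
                (a , a′) ≢ (b , b′) → Between a b x × Between a′ b′ x′
steps-between stepA stepB A≢B =
  steps-between₁ stepA stepB A≢B ,
  steps-between₁ (UnitStep-transpose stepA) (UnitStep-transpose stepB) (A≢B ∘ cong swap)

coords : {n : ℕ} → Cell n → ℕ × ℕ
coords (r , c) = toℕ r , toℕ c

coords-injective : {n : ℕ} → Injective {A = Cell n} _≡_ _≡_ coords
coords-injective e = cong₂ _,_ (toℕ-injective (cong proj₁ e)) (toℕ-injective (cong proj₂ e))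

-- Blocks of a permutation

injective⇒surjective : {n : ℕ} {g : Fin n → Fin n} → Injective _≡_ _≡_ g → (v : Fin n) → ∃ λ p → g p ≡ v
injective⇒surjective {suc n} {g} g-injective v with any? (λ p → g p ≟ v)
... | yes hit = hit
... | no  miss = contradiction (injective⇒≤ {f = squeeze} squeeze-injective) 1+n≰n
  where
  v≢g : (p : Fin (suc n)) → v ≢ g p
  v≢g p v≡gp = miss (p , sym v≡gp)
  squeeze : Fin (suc n) → Fin n
  squeeze p = punchOut (v≢g p)
  squeeze-injective : Injective _≡_ _≡_ squeeze
  squeeze-injective {p} {q} = g-injective ∘ punchOut-injective (v≢g p) (v≢g q)

prefix-image-≤ : {n j b : ℕ} (g : Fin n → Fin n) → Injective _≡_ _≡_ g → j < n →
                 ((p : Fin n) → toℕ p ≤ j → toℕ (g p) ≤ b) → j ≤ b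
prefix-image-≤ {n} {j} {b} g g-injective j<n bound = s≤s⁻¹ (injective⇒≤ {f = ψ} ψ-injective)
  where
  ψ : Fin (suc j) → Fin (suc b)
  ψ t = fromℕ< (s≤s (bound (inject≤ t j<n) (subst (_≤ j) (sym (toℕ-inject≤ t j<n)) (toℕ≤pred[n] t))))
  ψ-injective : Injective _≡_ _≡_ ψ
  ψ-injective {t} {t′} e = inject≤-injective j<n j<n t t′ (g-injective (toℕ-injective (fromℕ<-injective _ _ _ _ e)))

module _ {n : ℕ} {w : Word n} (perm : IsPerm w) where

  inverse : Fin n → Fin n
  inverse v = proj₁ (injective⇒surjective (perm _ _) v)

  lookup-inverse : (v : Fin n) → lookup w (inverse v) ≡ v
  lookup-inverse v = proj₂ (injective⇒surjective (perm _ _) v)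

  inverse-injective : Injective _≡_ _≡_ inverse
  inverse-injective {u} {v} e = begin
    u                      ≡⟨ lookup-inverse u ⟨
    lookup w (inverse u)   ≡⟨ cong (lookup w) e ⟩
    lookup w (inverse v)   ≡⟨ lookup-inverse v ⟩
    v                      ∎

record Block {n : ℕ} (w : Word n) : Set where
  field
    positions values : Interval
    image⊆    : (p : Fin n) → toℕ p ∈ᵢ positions → toℕ (lookup w p) ∈ᵢ values
    preimage⊆ : (p : Fin n) → toℕ (lookup w p) ∈ᵢ values → toℕ p ∈ᵢ positions
open Block

Proper : {n : ℕ} {w : Word n} → Block w → Set
Proper {n} B = ¬ ((p : Fin n) → toℕ p ∈ᵢ positions B)

singleton : {n : ℕ} {w : Word n} → IsPerm w → Fin n → Block w
singleton {n} {w} perm p = record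
  { positions = [ toℕ p , toℕ p ]
  ; values    = [ toℕ (lookup w p) , toℕ (lookup w p) ]
  ; image⊆    = image⊆′
  ; preimage⊆ = preimage⊆′
  }
  where
  image⊆′ : (q : Fin n) → toℕ q ∈ᵢ [ toℕ p , toℕ p ] →
            toℕ (lookup w q) ∈ᵢ [ toℕ (lookup w p) , toℕ (lookup w p) ]
  image⊆′ q q∈ with toℕ-injective (∈-point⁻ q∈)
  ... | refl = ∈-point⁺
  preimage⊆′ : (q : Fin n) → toℕ (lookup w q) ∈ᵢ [ toℕ (lookup w p) , toℕ (lookup w p) ] →
               toℕ q ∈ᵢ [ toℕ p , toℕ p ]
  preimage⊆′ q v∈ with perm q p (toℕ-injective (∈-point⁻ v∈))
  ... | refl = ∈-point⁺

singleton-proper : {m : ℕ} {w : Word (2 + m)} (perm : IsPerm w) (p : Fin (2 + m)) → Proper (singleton {w = w} perm p)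
singleton-proper perm p covers = contradiction (≤-trans (proj₂ (covers (suc zero))) (proj₁ (covers zero))) λ ()

merge : {n : ℕ} {w : Word n} (B C : Block w) →
        Touching (positions B) (positions C) → Touching (values B) (values C) → Block w
merge B C touch-positions touch-values = record
  { positions = positions B ∪ᵢ positions C
  ; values    = values B ∪ᵢ values C
  ; image⊆    = λ p → Sum.[ ∈-∪ˡ ∘ image⊆ B p , ∈-∪ʳ ∘ image⊆ C p ] ∘ ∈-∪⁻ touch-positions
  ; preimage⊆ = λ p → Sum.[ ∈-∪ˡ ∘ preimage⊆ B p , ∈-∪ʳ ∘ preimage⊆ C p ] ∘ ∈-∪⁻ touch-values
  }

values-touch : {n : ℕ} {w : Word n} (B C : Block w) (p : Fin n) →
               toℕ p ∈ᵢ positions B → toℕ p ∈ᵢ positions C → Touching (values B) (values C)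
values-touch B C p p∈B p∈C = touching-shared (image⊆ B p p∈B) (image⊆ C p p∈C)

positions-touch : {n : ℕ} {w : Word n} → IsPerm w → (B C : Block w) (v : Fin n) →
                  toℕ v ∈ᵢ values B → toℕ v ∈ᵢ values C → Touching (positions B) (positions C)
positions-touch {w = w} perm B C v v∈B v∈C = touching-shared (preimage⊆ B p (at v∈B)) (preimage⊆ C p (at v∈C))
  where
  p : Fin _
  p = inverse {w = w} perm v
  at : {I : Interval} → toℕ v ∈ᵢ I → toℕ (lookup w p) ∈ᵢ I
  at {I} = subst (λ u → toℕ u ∈ᵢ I) (sym (lookup-inverse {w = w} perm v))

mirror-block : {M : ℕ} {w w′ : Word (suc M)} → Complementary w w′ → (B : Block w) → lo (values B) ≤ M → Block w′
mirror-block {M} {w} {w′} comp B lo≤M = record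
  { positions = positions B
  ; values    = mirror M (values B)
  ; image⊆    = λ p p∈ → subst (_∈ᵢ mirror M (values B)) (sym (comp p)) (∈-mirror⁺ (image⊆ B p p∈))
  ; preimage⊆ = λ p v∈ → preimage⊆ B p (∈-mirror⁻ {I = values B} lo≤M (toℕ≤pred[n] (lookup w p))
                                         (subst (_∈ᵢ mirror M (values B)) (comp p) v∈))
  }

prefix-block-decomposes : {n : ℕ} {w : Word n} → IsPerm w → (B : Block w) → Proper B →
                          0 ∈ᵢ positions B → 0 ∈ᵢ values B → Decomposable w
prefix-block-decomposes {n} {w} perm B proper (lo-pos≤0 , _) (lo-val≤0 , _) = suc j , s≤s z≤n , 1+j<n , into , onto
  where
  w⁻¹ : Fin n → Fin n
  w⁻¹ = inverse {w = w} perm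
  w∘w⁻¹ : (v : Fin n) → lookup w (w⁻¹ v) ≡ v
  w∘w⁻¹ = lookup-inverse {w = w} perm
  j b : ℕ
  j = hi (positions B)
  b = hi (values B)
  position∈ : {t : ℕ} → t ≤ j → t ∈ᵢ positions B
  position∈ t≤j = ≤-trans lo-pos≤0 z≤n , t≤j
  value∈ : {t : ℕ} → t ≤ b → t ∈ᵢ values B
  value∈ t≤b = ≤-trans lo-val≤0 z≤n , t≤b
  1+j<n : suc j < n
  1+j<n with suc j <? n
  ... | yes 1+j<n = 1+j<n
  ... | no  1+j≮n = contradiction (λ p → position∈ (s≤s⁻¹ (≤-trans (toℕ<n p) (≮⇒≥ 1+j≮n)))) proper
  b<n : b < n
  b<n with b <? n
  ... | yes b<n = b<n
  ... | no  b≮n =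
    contradiction (λ p → preimage⊆ B p (value∈ (≤-trans (<⇒≤ (toℕ<n (lookup w p))) (≮⇒≥ b≮n)))) proper
  j≤b : j ≤ b
  j≤b = prefix-image-≤ (lookup w) (perm _ _) (<⇒≤ 1+j<n) (λ p p≤j → proj₂ (image⊆ B p (position∈ p≤j)))
  b≤j : b ≤ j
  b≤j = prefix-image-≤ w⁻¹ (inverse-injective {w = w} perm) b<n λ v v≤b →
    proj₂ (preimage⊆ B (w⁻¹ v) (value∈ (subst (_≤ b) (cong toℕ (sym (w∘w⁻¹ v))) v≤b)))
  into : (i : Fin n) → toℕ i < suc j → toℕ (lookup w i) < suc j
  into i (s≤s i≤j) = s≤s (≤-trans (proj₂ (image⊆ B i (position∈ i≤j))) b≤j)
  onto : (v : Fin n) → toℕ v < suc j → Σ (Fin n) λ i → toℕ i < suc j × lookup w i ≡ v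
  onto v (s≤s v≤j) = w⁻¹ v , s≤s (proj₂ (preimage⊆ B (w⁻¹ v) (value∈ v≤b))) , w∘w⁻¹ v
    where
    v≤b : toℕ (lookup w (w⁻¹ v)) ≤ b
    v≤b = subst (_≤ b) (cong toℕ (sym (w∘w⁻¹ v))) (≤-trans v≤j j≤b)

-- Bootstrap percolation

module Percolation {m : ℕ} {x : Word (2 + m)} (perm : IsPerm x) where

  -- lookup x̄ p is the row of the 1 in column p.
  x̄ : Word (2 + m)
  x̄ = complement x

  perm̄ : IsPerm x̄
  perm̄ = IsPerm-complement {x = x} perm

  Decomposition : Set
  Decomposition = Decomposable x ⊎ Decomposable x̄

  Covered : Cell (2 + m) → Set
  Covered (r , c) = Σ (Block x̄) λ B → Proper B × toℕ c ∈ᵢ positions B × toℕ r ∈ᵢ values B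

  last : Fin (2 + m)
  last = fromℕ (suc m)

  initial-covered : (p : Fin (2 + m)) → Covered (opposite (lookup x p) , p)
  initial-covered p =
    B , singleton-proper {w = x̄} perm̄ p , ∈-point⁺ ,
    subst (λ v → toℕ v ∈ᵢ values B) (lookup-complement x p) ∈-point⁺
    where
    B : Block x̄
    B = singleton perm̄ p

  values-cover : (B C : Block x̄) → ((p : Fin (2 + m)) → toℕ p ∈ᵢ positions B ⊎ toℕ p ∈ᵢ positions C) →
                 (v : Fin (2 + m)) → toℕ v ∈ᵢ values B ⊎ toℕ v ∈ᵢ values C
  values-cover B C covers v with inverse {w = x̄} perm̄ v | lookup-inverse {w = x̄} perm̄ v
  ... | p | refl = Sum.map (image⊆ B p) (image⊆ C p) (covers p)

  -- The values of B contain 0 (then B decomposes x̄) or n-1 (then its mirror image decomposes x);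
  -- otherwise those of C contain both, hence all values, and C is not proper.
  block-at-origin-decomposes : (B C : Block x̄) → Proper B → Proper C → 0 ∈ᵢ positions B →
                               ((v : Fin (2 + m)) → toℕ v ∈ᵢ values B ⊎ toℕ v ∈ᵢ values C) → Decomposition
  block-at-origin-decomposes B C B-proper C-proper 0∈B covers with covers zero | covers last
  ... | inj₁ 0∈values-B | _ = inj₂ (prefix-block-decomposes perm̄ B B-proper 0∈B 0∈values-B)
  ... | inj₂ _          | inj₁ last∈values-B =
    inj₁ (prefix-block-decomposes perm (mirror-block {w = x̄} {x} x̄-x B (proj₁ M∈values-B)) B-proper 0∈B 0∈mirror)
    where
    x̄-x : Complementary x̄ x
    x̄-x = Complementary-sym {w = x} {x̄} (complement-complementary x)
    M∈values-B : suc m ∈ᵢ values B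
    M∈values-B = subst (_∈ᵢ values B) (toℕ-fromℕ (suc m)) last∈values-B
    0∈mirror : 0 ∈ᵢ mirror (suc m) (values B)
    0∈mirror = subst (_∈ᵢ mirror (suc m) (values B)) (n∸n≡0 (suc m)) (∈-mirror⁺ M∈values-B)
  ... | inj₂ 0∈values-C | inj₂ last∈values-C =
    contradiction (λ p → preimage⊆ C p (∈-convex 0∈values-C last∈values-C z≤n (≤fromℕ (lookup x̄ p)))) C-proper

  spanning-union-decomposes : (B C : Block x̄) → Proper B → Proper C → Touching (positions B) (positions C) →
                              ((p : Fin (2 + m)) → toℕ p ∈ᵢ positions B ∪ᵢ positions C) → Decomposition
  spanning-union-decomposes B C B-proper C-proper touch spans = Sum.[
      (λ 0∈B → block-at-origin-decomposes B C B-proper C-proper 0∈B (values-cover B C covers))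
    , (λ 0∈C → block-at-origin-decomposes C B C-proper B-proper 0∈C (values-cover C B (Sum.swap ∘ covers)))
    ] (covers zero)
    where
    covers : (p : Fin (2 + m)) → toℕ p ∈ᵢ positions B ⊎ toℕ p ∈ᵢ positions C
    covers p = ∈-∪⁻ touch (spans p)

  merge-proper-or-decomposes : (B C : Block x̄) → Proper B → Proper C →
    (touch-positions : Touching (positions B) (positions C)) (touch-values : Touching (values B) (values C)) →
    Proper (merge B C touch-positions touch-values) ⊎ Decomposition
  merge-proper-or-decomposes B C B-proper C-proper touch-positions _
    with all? (λ p → toℕ p ∈ᵢ? positions B ∪ᵢ positions C)
  ... | yes spans = inj₂ (spanning-union-decomposes B C B-proper C-proper touch-positions spans)
  ... | no ¬spans = inj₁ ¬spans

  merge-covered : {A B X : Cell (2 + m)} → A ≢ B → Adjacent A X → Adjacent B X →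
                  Covered A → Covered B → Covered X ⊎ Decomposition
  merge-covered {rA , cA} {rB , cB} {r , c} A≢B adjA adjB
                (B₁ , B₁-proper , cA∈ , rA∈) (B₂ , B₂-proper , cB∈ , rB∈) =
    Sum.map₁ (λ proper → U , proper , ∈-∪-between cA∈ cB∈ (proj₂ between) , ∈-∪-between rA∈ rB∈ (proj₁ between))
             (merge-proper-or-decomposes B₁ B₂ B₁-proper B₂-proper touch-positions touch-values)
    where
    stepA : UnitStep (toℕ rA , toℕ cA) (toℕ r , toℕ c)
    stepA = unit-step adjA
    stepB : UnitStep (toℕ rB , toℕ cB) (toℕ r , toℕ c)
    stepB = unit-step adjB
    touch-positions : Touching (positions B₁) (positions B₂)
    touch-positions with steps-near-or-aligned (UnitStep-transpose stepA) (UnitStep-transpose stepB)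
    ... | inj₁ (cA≤1+cB , cB≤1+cA) = touching-near cA∈ cB∈ cA≤1+cB cB≤1+cA
    ... | inj₂ rA≡rB = positions-touch perm̄ B₁ B₂ rA rA∈ (subst (_∈ᵢ values B₂) (sym rA≡rB) rB∈)
    touch-values : Touching (values B₁) (values B₂)
    touch-values with steps-near-or-aligned stepA stepB
    ... | inj₁ (rA≤1+rB , rB≤1+rA) = touching-near rA∈ rB∈ rA≤1+rB rB≤1+rA
    ... | inj₂ cA≡cB = values-touch B₁ B₂ cA cA∈ (subst (_∈ᵢ positions B₂) (sym cA≡cB) cB∈)
    U : Block x̄
    U = merge B₁ B₂ touch-positions touch-values
    between : Between (toℕ rA) (toℕ rB) (toℕ r) × Between (toℕ cA) (toℕ cB) (toℕ c)
    between = steps-between stepA stepB (A≢B ∘ coords-injective)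

  infected-covered : {X : Cell (2 + m)} → Infected x X → Covered X ⊎ Decomposition
  infected-covered (initial p) = inj₁ (initial-covered p)
  infected-covered (spread A≢B adjA adjB infA infB) with infected-covered infA | infected-covered infB
  ... | inj₂ d      | _          = inj₂ d
  ... | inj₁ _      | inj₂ d     = inj₂ d
  ... | inj₁ cov-A  | inj₁ cov-B = merge-covered A≢B adjA adjB cov-A cov-B

  corner-uncovered : ¬ Covered (lookup x̄ last , zero)
  corner-uncovered (B , B-proper , 0∈B , v∈B) =
    B-proper (λ p → ∈-convex 0∈B (preimage⊆ B last v∈B) z≤n (≤fromℕ p))

  full⇒decomposition : Full x → Decomposition
  full⇒decomposition full = Sum.[ ⊥-elim ∘ corner-uncovered , id ] (infected-covered (full (lookup x̄ last , zero)))

complement-decomposable⇔indecomposable : {m : ℕ} {x : Word (2 + m)} → IsPerm x → Full x →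
                                          Decomposable (complement x) ⇔ (¬ Decomposable x)
complement-decomposable⇔indecomposable {x = x} perm full = mk⇔
  (λ d̄ d → not-both-decomposable {w = x} {complement x} (complement-complementary x) d d̄)
  (λ ¬d → Sum.[ ⊥-elim ∘ ¬d , id ] (Percolation.full⇒decomposition perm full))

corollary4p6 : (n : ℕ) → 2 ≤ n →
    (perm? : Decidable (IsPerm {n})) (full? : Decidable (Full {n}))
    (dec? : Decidable (Decomposable {n})) →
    (2 * count (λ π → ¬? (dec? π)) (fullPerms n perm? full?) ≡ length (fullPerms n perm? full?))
    × (2 * count dec? (fullPerms n perm? full?) ≡ length (fullPerms n perm? full?))
corollary4p6 (suc zero) (s≤s ()) _ _ _
corollary4p6 (suc (suc m)) _ perm? full? dec? =
  exactly-half dec? complement (fullPerms-complement-↭ (2 + m) perm? full?)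
    (All.map (λ (perm , full) → complement-decomposable⇔indecomposable perm full)
             (fullPerms-sound (2 + m) perm? full?))
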